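{- For $n\ge 0$ let $P^{(2)}_n(z_1,z_2)$ be the polynomial $\sum_{\pi} z_1^{a_1(\pi)} z_2^{a_2(\pi)}$, where $\pi$ ranges over all multiset set-partitions of the multiset $\{1^2,2^2,\dots,n^2\}$, $a_1(\pi)$ is the number of distinct sets of $\pi$ that appear exactly once in $\pi$ and $a_2(\pi)$ is the number of distinct sets of $\pi$ that appear exactly twice in $\pi$ (so $P^{(2)}_0=1$). Let $D_1=\partial/\partial z_1$, $D_2=\partial/\partial z_2$ and let $\mathcal{D}_2$ be the partial differential operator $$\mathcal{D}_2 := z_2D_2+\tfrac12 z_1^4D_2^2+z_1^3D_1D_2+\tfrac12 z_1^2D_1^2+z_1^3D_2+z_1^2D_1+z_2 ,$$ where each term means: first apply the indicated derivatives, then multiply by the indicated monomial. Then for every $n\ge1$, $$P^{(2)}_n(z_1,z_2)=\mathcal{D}_2\, P^{(2)}_{n-1}(z_1,z_2),$$ and the number of multiset set-partitions of $\{1^2,\dots,n^2\}$ equals $P^{(2)}_n(1,1)$.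
   Context: A multiset set-partition of the multiset $\{1^r,2^r,\dots,n^r\}$ (each of $1,\dots,n$ appearing $r$ times) is a finite multiset (unordered, repetitions allowed) of nonempty subsets of $\{1,\dots,n\}$ such that every $i\in\{1,\dots,n\}$ belongs to exactly $r$ of the sets, counted with multiplicity. In particular no set contains two copies of the same element; a given set may occur several times. For $n=0$ there is exactly one (empty) partition. -}

module Defs where

open import Data.Bool using (Bool; true; false; _∧_; if_then_else_)
open import Data.Nat using (ℕ; zero; suc; _+_; _∸_; _≡ᵇ_)
open import Data.Fin using (Fin)
open import Data.Vec using (Vec; []; _∷_; lookup)
open import Data.List using (List; []; _∷_; map; _++_; concatMap; filterᵇ; foldr; length; allFin)
import Data.List as L
open import Data.Product using (_×_; _,_)
open import Data.Integer using (+_)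
open import Data.Rational using (ℚ; _/_; 0ℚ; 1ℚ; ½)
import Data.Rational as Q
open import Relation.Binary.PropositionalEquality using (_≡_)

Subset : ℕ → Set
Subset n = Vec Bool n

allSubsets : (n : ℕ) → List (Subset n)
allSubsets zero    = [] ∷ []
allSubsets (suc n) = map (true ∷_) (allSubsets n) ++ map (false ∷_) (allSubsets n)

nonempty : ∀ {n} → Subset n → Bool
nonempty []          = false
nonempty (true ∷ _)  = true
nonempty (false ∷ s) = nonempty s

nonemptySubsets : (n : ℕ) → List (Subset n)
nonemptySubsets n = filterᵇ nonempty (allSubsets n)

-- A finite multiset of nonempty subsets is given by its multiplicity
-- function, stored as the list of pairs (S , multiplicity of S), one pair
-- for every nonempty subset S (in the fixed order of nonemptySubsets n).
Multiset : ℕ → Set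
Multiset n = List (Subset n × ℕ)

-- all multiplicity assignments with multiplicities in {0,1,2} to the
-- given list of subsets.  (In a partition of {1^2,…,n^2} every set has
-- multiplicity ≤ 2, since it contains some i, which is covered exactly
-- twice; so this enumeration contains all partitions.)
assignments : ∀ {n} → List (Subset n) → List (Multiset n)
assignments []       = [] ∷ []
assignments (S ∷ Ss) =
  concatMap (λ m → map (λ rest → (S , m) ∷ rest) (assignments Ss))
            (0 ∷ 1 ∷ 2 ∷ [])

cover : ∀ {n} → Fin n → Multiset n → ℕ
cover i []            = 0
cover i ((S , k) ∷ π) = (if lookup S i then k else 0) + cover i π

allᵇ : {A : Set} → (A → Bool) → List A → Bool
allᵇ f = foldr (λ x acc → f x ∧ acc) true

isPartition : ∀ {n} → Multiset n → Bool
isPartition {n} π = allᵇ (λ i → cover i π ≡ᵇ 2) (allFin n)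

partitions : (n : ℕ) → List (Multiset n)
partitions n = filterᵇ isPartition (assignments (nonemptySubsets n))

aCount : ∀ {n} → ℕ → Multiset n → ℕ
aCount k π = length (filterᵇ (λ p → Data.Product.proj₂ p ≡ᵇ k) π)

Poly : Set
Poly = List (ℚ × ℕ × ℕ)

ℕtoℚ : ℕ → ℚ
ℕtoℚ k = (+ k) / 1

coeff : Poly → ℕ → ℕ → ℚ
coeff p i j = foldr (λ { (c , a , b) acc →
  (if (a ≡ᵇ i) ∧ (b ≡ᵇ j) then c else 0ℚ) Q.+ acc }) 0ℚ p

_≈P_ : Poly → Poly → Set
p ≈P q = ∀ i j → coeff p i j ≡ coeff q i j

infix 4 _≈P_

powQ : ℚ → ℕ → ℚ
powQ x zero    = 1ℚ
powQ x (suc k) = x Q.* powQ x k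

eval : Poly → ℚ → ℚ → ℚ
eval p x y = foldr (λ { (c , a , b) acc → c Q.* powQ x a Q.* powQ y b Q.+ acc }) 0ℚ p

D₁ : Poly → Poly
D₁ = map (λ { (c , a , b) → (c Q.* ℕtoℚ a , a ∸ 1 , b) })

D₂ : Poly → Poly
D₂ = map (λ { (c , a , b) → (c Q.* ℕtoℚ b , a , b ∸ 1) })

mulMon : ℚ → ℕ → ℕ → Poly → Poly
mulMon q a b = map (λ { (c , a' , b') → (q Q.* c , a + a' , b + b') })

_⊕_ : Poly → Poly → Poly
_⊕_ = _++_

infixr 5 _⊕_

𝒟₂ : Poly → Poly
𝒟₂ p =  mulMon 1ℚ 0 1 (D₂ p)
      ⊕ mulMon ½ 4 0 (D₂ (D₂ p))
      ⊕ mulMon 1ℚ 3 0 (D₁ (D₂ p))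
      ⊕ mulMon ½ 2 0 (D₁ (D₁ p))
      ⊕ mulMon 1ℚ 3 0 (D₂ p)
      ⊕ mulMon 1ℚ 2 0 (D₁ p)
      ⊕ mulMon 1ℚ 0 1 p

P⁽²⁾ : ℕ → Poly
P⁽²⁾ n = map (λ π → (1ℚ , aCount 1 π , aCount 2 π)) (partitions n)

-- Removing the new element ⋆ from every block maps a partition of {1²,…,(n+1)²} onto one of
-- {1²,…,n²}, and a partition with a₁ simple and a₂ double blocks has the following preimages:
-- the two copies of ⋆ form a double block {⋆} (term z₂), or a simple block {⋆} together with
-- ⋆ added to a simple block (z₁²D₁) or to one copy of a double block (z₁³D₂), or ⋆ is added to
-- two simple blocks (½z₁²D₁²), to a simple block and one copy of a double block (z₁³D₁D₂), to one
-- copy each of two double blocks (½z₁⁴D₂²), or to both copies of a double block (z₂D₂).  A double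
-- block receiving one copy of ⋆ splits into two simple blocks, and each term of 𝒟₂ applied to
-- z₁^a₁ z₂^a₂ is exactly the number of choices times the resulting monomial.

module Submission where

open import Defs

import Algebra.Solver.CommutativeMonoid as CommutativeMonoidSolver
open import Data.Bool using (Bool; true; false; _∧_; if_then_else_; T; T?)
open import Data.Empty using (⊥-elim)
open import Data.Fin using (Fin; zero; suc)
import Data.Integer as ℤ
import Data.Integer.Properties as ℤ
open import Data.List using (List; []; _∷_; [_]; map; _++_; concatMap; filterᵇ; replicate; length; tabulate)
open import Data.List.Properties
  using (concatMap-++; concatMap-map; map-concatMap; concatMap-cong; map-++; map-∘; ++-identityʳ; ++-assoc; filter-++)
open import Data.List.Relation.Binary.Permutation.Propositional
  using (_↭_; ↭-refl; ↭-sym; ↭-trans; ↭-reflexive; module PermutationReasoning)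
import Data.List.Relation.Binary.Permutation.Propositional as ↭
open import Data.List.Relation.Binary.Permutation.Propositional.Properties using (++⁺; ++-commutativeMonoid)
open import Data.List.Relation.Unary.All as ListAll using ([]; _∷_)
open import Data.List.Relation.Unary.All.Properties using (all-filter)
open import Data.Nat using (ℕ; zero; suc; _+_; _*_; _∸_; _≡ᵇ_; _≤_; s≤s; z≤n)
import Data.Nat.Coprimality as Coprime
import Data.Nat.Properties as ℕ
open import Data.Nat.Tactic.RingSolver using (solve-∀)
open import Data.Product using (Σ; _×_; _,_; proj₁; proj₂)
open import Data.Rational using (ℚ; 1ℚ; 0ℚ; ½; mkℚ)
import Data.Rational as ℚ hiding (ℚ)
import Data.Rational.Properties as ℚ
open import Data.Sum using (_⊎_; inj₁; inj₂)
open import Data.Unit using (tt)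
open import Data.Vec using (Vec; []; _∷_; lookup; zipWith; sum)
open import Data.Vec.Relation.Unary.All using (All; []; _∷_)
open import Data.Vec.Relation.Unary.Any using (Any; here; there)
open import Function using (_∘_)
open import Relation.Binary.Bundles using (Setoid)
import Relation.Binary.Reasoning.Setoid as SetoidReasoning
open import Relation.Binary.PropositionalEquality hiding ([_])

private variable
  A B C : Set

module ↭-Solver {A : Set} = CommutativeMonoidSolver (++-commutativeMonoid {A = A})

-- Finite sums as lists of terms

when : Bool → List A → List A
when true  xs = xs
when false xs = []

concatMap-concatMap : (f : B → List C) (g : A → List B) (xs : List A) →
  concatMap f (concatMap g xs) ≡ concatMap (concatMap f ∘ g) xs
concatMap-concatMap f g []       = refl
concatMap-concatMap f g (x ∷ xs) =
  trans (concatMap-++ f (g x) (concatMap g xs)) (cong (concatMap f (g x) ++_) (concatMap-concatMap f g xs))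

concatMap-[] : (xs : List A) → concatMap {B = B} (λ _ → []) xs ≡ []
concatMap-[] []       = refl
concatMap-[] (x ∷ xs) = concatMap-[] xs

concatMap⁺ : {f g : A → List B} → (∀ x → f x ↭ g x) → (xs : List A) → concatMap f xs ↭ concatMap g xs
concatMap⁺ f↭g []       = ↭-refl
concatMap⁺ f↭g (x ∷ xs) = ++⁺ (f↭g x) (concatMap⁺ f↭g xs)

concatMap-++-distrib : (f g : A → List B) (xs : List A) →
  concatMap (λ x → f x ++ g x) xs ↭ concatMap f xs ++ concatMap g xs
concatMap-++-distrib f g []       = ↭-refl
concatMap-++-distrib f g (x ∷ xs) =
  ↭-trans (++⁺ (↭-refl {x = f x ++ g x}) (concatMap-++-distrib f g xs))
          (solve 4 (λ a b c d → (a ⊞ b) ⊞ (c ⊞ d) ⊜ (a ⊞ c) ⊞ (b ⊞ d)) ↭-refl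
                   (f x) (g x) (concatMap f xs) (concatMap g xs))
  where open ↭-Solver renaming (_⊕_ to _⊞_)

concatMap-comm : (h : A → B → List C) (xs : List A) (ys : List B) →
  concatMap (λ x → concatMap (h x) ys) xs ↭ concatMap (λ y → concatMap (λ x → h x y) xs) ys
concatMap-comm h []       ys = ↭-reflexive (sym (concatMap-[] ys))
concatMap-comm h (x ∷ xs) ys =
  ↭-trans (++⁺ (↭-refl {x = concatMap (h x) ys}) (concatMap-comm h xs ys))
          (↭-sym (concatMap-++-distrib (h x) (λ y → concatMap (λ x → h x y) xs) ys))

when-concatMap : (c : Bool) (f : A → List B) (xs : List A) →
  when c (concatMap f xs) ≡ concatMap (when c ∘ f) xs
when-concatMap true  f xs = refl
when-concatMap false f xs = sym (concatMap-[] xs)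

when⁺ : (c : Bool) {xs ys : List A} → xs ↭ ys → when c xs ↭ when c ys
when⁺ true  p = p
when⁺ false p = ↭-refl

when-∧ : ∀ b c (xs : List A) → when (b ∧ c) xs ≡ when c (when b xs)
when-∧ true  c     xs = refl
when-∧ false true  xs = refl
when-∧ false false xs = refl

map-filterᵇ : (f : A → B) (p : A → Bool) (xs : List A) →
  map f (filterᵇ p xs) ≡ concatMap (λ x → when (p x) [ f x ]) xs
map-filterᵇ f p []       = refl
map-filterᵇ f p (x ∷ xs) with p x
... | true  = cong (f x ∷_) (map-filterᵇ f p xs)
... | false = map-filterᵇ f p xs

0‥2 : List ℕ
0‥2 = 0 ∷ 1 ∷ 2 ∷ []

multiplicities : (k : ℕ) → List (Vec ℕ k)
multiplicities zero    = [] ∷ []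
multiplicities (suc k) = concatMap (λ m → map (m ∷_) (multiplicities k)) 0‥2

concatMap-multiplicities-suc : ∀ k (F : Vec ℕ (suc k) → List B) →
  concatMap F (multiplicities (suc k)) ≡
    concatMap (F ∘ (0 ∷_)) (multiplicities k) ++ concatMap (F ∘ (1 ∷_)) (multiplicities k)
      ++ concatMap (F ∘ (2 ∷_)) (multiplicities k) ++ []
concatMap-multiplicities-suc k F =
  trans (concatMap-concatMap F (λ m → map (m ∷_) (multiplicities k)) 0‥2)
        (cong₂ _++_ (concatMap-map F (0 ∷_) ms)
          (cong₂ _++_ (concatMap-map F (1 ∷_) ms) (cong₂ _++_ (concatMap-map F (2 ∷_) ms) refl)))
  where
  ms : List (Vec ℕ k)
  ms = multiplicities k

-- The pairs (g , b) with g + b = p, for p ≤ 2 (the only multiplicities that occur).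
splits₁ : ℕ → List (ℕ × ℕ)
splits₁ 0 = (0 , 0) ∷ []
splits₁ 1 = (0 , 1) ∷ (1 , 0) ∷ []
splits₁ 2 = (0 , 2) ∷ (1 , 1) ∷ (2 , 0) ∷ []
splits₁ _ = []

splits : ∀ {k} → Vec ℕ k → List (Vec ℕ k × Vec ℕ k)
splits []      = ([] , []) ∷ []
splits (p ∷ v) =
  concatMap (λ gb → map (λ γβ → (proj₁ gb ∷ proj₁ γβ , proj₂ gb ∷ proj₂ γβ)) (splits v)) (splits₁ p)

_⊕ᵥ_ : ∀ {k} → Vec ℕ k → Vec ℕ k → Vec ℕ k
_⊕ᵥ_ = zipWith _+_

sumOverSplits : ∀ {k} → (Vec ℕ k → Vec ℕ k → List B) → Vec ℕ k → List B
sumOverSplits w p = concatMap (λ gb → w (proj₁ gb) (proj₂ gb)) (splits p)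

sumOverSplits-∷ : ∀ {k} (w : Vec ℕ (suc k) → Vec ℕ (suc k) → List B) (p : ℕ) (v : Vec ℕ k) →
  sumOverSplits w (p ∷ v) ≡
    concatMap (λ gb → sumOverSplits (λ γ β → w (proj₁ gb ∷ γ) (proj₂ gb ∷ β)) v) (splits₁ p)
sumOverSplits-∷ w p v =
  trans (concatMap-concatMap _ _ (splits₁ p)) (concatMap-cong (λ gb → concatMap-map _ _ (splits v)) (splits₁ p))

concatMap-multiplicities-cong : ∀ k {f g : Vec ℕ k → List B} → (∀ p → All (_≤ 2) p → f p ↭ g p) →
  concatMap f (multiplicities k) ↭ concatMap g (multiplicities k)
concatMap-multiplicities-cong zero    f↭g = ++⁺ (f↭g [] []) ↭-refl
concatMap-multiplicities-cong (suc k) {f} {g} f↭g =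
  ↭-trans (↭-reflexive (concatMap-multiplicities-suc k f))
  (↭-trans (++⁺ (concatMap-multiplicities-cong k (λ p p≤2 → f↭g (0 ∷ p) (z≤n ∷ p≤2)))
           (++⁺ (concatMap-multiplicities-cong k (λ p p≤2 → f↭g (1 ∷ p) (s≤s z≤n ∷ p≤2)))
           (++⁺ (concatMap-multiplicities-cong k (λ p p≤2 → f↭g (2 ∷ p) (s≤s (s≤s z≤n) ∷ p≤2))) ↭-refl)))
           (↭-sym (↭-reflexive (concatMap-multiplicities-suc k g))))

VanishesAbove2 : ∀ {k} → (Vec ℕ k → Bool) → Set
VanishesAbove2 φ = ∀ v → Any (3 ≤_) v → φ v ≡ false

pairSum : ∀ k → (Vec ℕ k → Bool) → (Vec ℕ k → Vec ℕ k → List B) → List B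
pairSum k φ w =
  concatMap (λ g → concatMap (λ b → when (φ (g ⊕ᵥ b)) (w g b)) (multiplicities k)) (multiplicities k)

splitSum : ∀ k → (Vec ℕ k → Bool) → (Vec ℕ k → Vec ℕ k → List B) → List B
splitSum k φ w = concatMap (λ p → when (φ p) (sumOverSplits w p)) (multiplicities k)

pairSum-false : ∀ k (φ : Vec ℕ k → Bool) (w : Vec ℕ k → Vec ℕ k → List B) →
  (∀ v → φ v ≡ false) → pairSum k φ w ≡ []
pairSum-false k φ w φ≡false =
  trans (concatMap-cong (λ g → trans (concatMap-cong (λ b → cong (λ t → when t (w g b)) (φ≡false (g ⊕ᵥ b))) ms)
                                     (concatMap-[] ms))
                        ms)
        (concatMap-[] ms)
  where
  ms : List (Vec ℕ k)
  ms = multiplicities k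

pairSum-∷ : ∀ k (φ : Vec ℕ (suc k) → Bool) (w : Vec ℕ (suc k) → Vec ℕ (suc k) → List B) g →
  concatMap (λ γ → concatMap (λ b → when (φ ((g ∷ γ) ⊕ᵥ b)) (w (g ∷ γ) b)) (multiplicities (suc k))) (multiplicities k)
    ↭ concatMap (λ b → pairSum k (λ p → φ ((g + b) ∷ p)) (λ γ β → w (g ∷ γ) (b ∷ β))) 0‥2
pairSum-∷ k φ w g =
  ↭-trans (↭-reflexive (concatMap-cong (λ γ → concatMap-multiplicities-suc k _) ms))
  (↭-trans (concatMap-++-distrib _ _ ms) (++⁺ ↭-refl
  (↭-trans (concatMap-++-distrib _ _ ms) (++⁺ ↭-refl
  (↭-trans (concatMap-++-distrib _ _ ms) (++⁺ ↭-refl (↭-reflexive (concatMap-[] ms))))))))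
  where
  ms : List (Vec ℕ k)
  ms = multiplicities k

splitSum-∷ : ∀ k (φ : Vec ℕ (suc k) → Bool) (w : Vec ℕ (suc k) → Vec ℕ (suc k) → List B) p →
  concatMap (λ v → when (φ (p ∷ v)) (sumOverSplits w (p ∷ v))) (multiplicities k)
    ↭ concatMap (λ (g , b) → splitSum k (λ v → φ (p ∷ v)) (λ γ β → w (g ∷ γ) (b ∷ β))) (splits₁ p)
splitSum-∷ k φ w p = ↭-trans
  (↭-reflexive (concatMap-cong (λ v → trans (cong (when (φ (p ∷ v))) (sumOverSplits-∷ w p v))
                                            (when-concatMap (φ (p ∷ v)) _ (splits₁ p))) ms))
  (concatMap-comm _ ms (splits₁ p))
  where
  ms : List (Vec ℕ k)
  ms = multiplicities k

-- Induction on the length: split off the first coordinates (g₀ , b₀) ∈ {0,1,2}² and regroup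
-- them by their sum; the pairs with g₀ + b₀ ≥ 3 contribute nothing since φ vanishes there.
pairSum↭splitSum : ∀ k (φ : Vec ℕ k → Bool) (w : Vec ℕ k → Vec ℕ k → List B) →
  VanishesAbove2 φ → pairSum k φ w ↭ splitSum k φ w
pairSum↭splitSum zero φ w _ =
  ↭-reflexive (cong (_++ []) (trans (++-identityʳ _) (cong (when (φ [])) (sym (++-identityʳ _)))))
pairSum↭splitSum {B = B} (suc k) φ w φ-vanishes = ↭-trans byFirstPair (↭-trans regroup (↭-sym byFirstSum))
  where
  Y : ℕ → ℕ → List B
  Y g b = splitSum k (λ p → φ ((g + b) ∷ p)) (λ γ β → w (g ∷ γ) (b ∷ β))
  X : ℕ → ℕ → List B
  X g b = pairSum k (λ p → φ ((g + b) ∷ p)) (λ γ β → w (g ∷ γ) (b ∷ β))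
  tail-vanishes : ∀ c → VanishesAbove2 (λ p → φ (c ∷ p))
  tail-vanishes c v big = φ-vanishes (c ∷ v) (there big)
  X↭Y : ∀ g b → X g b ↭ Y g b
  X↭Y g b = pairSum↭splitSum k _ _ (tail-vanishes (g + b))
  large : ∀ g b → 3 ≤ g + b → X g b ≡ []
  large g b 3≤g+b = pairSum-false k _ _ (λ v → φ-vanishes ((g + b) ∷ v) (here 3≤g+b))
  3≤3 : 3 ≤ 3
  3≤3 = s≤s (s≤s (s≤s z≤n))
  byFirstPair : pairSum (suc k) φ w ↭
    (Y 0 0 ++ Y 0 1 ++ Y 0 2 ++ []) ++ (Y 1 0 ++ Y 1 1 ++ [] ++ []) ++ (Y 2 0 ++ [] ++ [] ++ []) ++ []
  byFirstPair = ↭-trans (↭-reflexive (concatMap-multiplicities-suc k _))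
    (++⁺ (↭-trans (pairSum-∷ k φ w 0) (++⁺ (X↭Y 0 0) (++⁺ (X↭Y 0 1) (++⁺ (X↭Y 0 2) ↭-refl))))
    (++⁺ (↭-trans (pairSum-∷ k φ w 1) (++⁺ (X↭Y 1 0) (++⁺ (X↭Y 1 1) (++⁺ (↭-reflexive (large 1 2 3≤3)) ↭-refl))))
    (++⁺ (↭-trans (pairSum-∷ k φ w 2) (++⁺ (X↭Y 2 0) (++⁺ (↭-reflexive (large 2 1 3≤3))
                                    (++⁺ (↭-reflexive (large 2 2 (ℕ.m≤n⇒m≤1+n 3≤3))) ↭-refl))))
      ↭-refl)))
  byFirstSum : splitSum (suc k) φ w ↭ (Y 0 0 ++ []) ++ (Y 0 1 ++ Y 1 0 ++ []) ++ (Y 0 2 ++ Y 1 1 ++ Y 2 0 ++ []) ++ []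
  byFirstSum = ↭-trans (↭-reflexive (concatMap-multiplicities-suc k _))
    (++⁺ (splitSum-∷ k φ w 0) (++⁺ (splitSum-∷ k φ w 1) (++⁺ (splitSum-∷ k φ w 2) ↭-refl)))
  regroup : (Y 0 0 ++ Y 0 1 ++ Y 0 2 ++ []) ++ (Y 1 0 ++ Y 1 1 ++ [] ++ []) ++ (Y 2 0 ++ [] ++ [] ++ []) ++ []
          ↭ (Y 0 0 ++ []) ++ (Y 0 1 ++ Y 1 0 ++ []) ++ (Y 0 2 ++ Y 1 1 ++ Y 2 0 ++ []) ++ []
  regroup = solve 6 (λ a b c d e f → (a ⊞ b ⊞ c ⊞ id) ⊞ (d ⊞ e ⊞ id ⊞ id) ⊞ (f ⊞ id ⊞ id ⊞ id) ⊞ id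
                                   ⊜ (a ⊞ id) ⊞ (b ⊞ d ⊞ id) ⊞ (c ⊞ e ⊞ f ⊞ id) ⊞ id)
                    ↭-refl (Y 0 0) (Y 0 1) (Y 0 2) (Y 1 0) (Y 1 1) (Y 2 0)
    where open ↭-Solver renaming (_⊕_ to _⊞_)

-- Placing the new element

δ : ℕ → ℕ → ℕ
δ k m = if m ≡ᵇ k then 1 else 0

count : ∀ {k} → ℕ → Vec ℕ k → ℕ
count j []      = 0
count j (c ∷ v) = δ j c + count j v

monomial : ℕ → ℕ → Poly
monomial a b = (1ℚ , a , b) ∷ []

-- weightAcc g b s e₁ e₂ is the monomial of the multiset with multiplicities g for the blocks
-- T ∪ {⋆} and b for the blocks T, where ⋆ is the new element and s copies of ⋆ as well as
-- the exponents e₁, e₂ have been accumulated already; it is empty unless ⋆ is covered twice.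
weightAcc : ∀ {k} → Vec ℕ k → Vec ℕ k → ℕ → ℕ → ℕ → Poly
weightAcc []      []      s e₁ e₂ = when (s ≡ᵇ 2) (monomial e₁ e₂)
weightAcc (g ∷ γ) (b ∷ β) s e₁ e₂ = weightAcc γ β (g + s) (δ 1 g + (δ 1 b + e₁)) (δ 2 g + (δ 2 b + e₂))

splitWeights : ∀ {k} → ℕ → ℕ → ℕ → Vec ℕ k → Poly
splitWeights s e₁ e₂ = sumOverSplits (λ γ β → weightAcc γ β s e₁ e₂)

copies : ℕ → ℕ → ℕ → Poly
copies k x y = replicate k (1ℚ , x , y)

choose2 : ℕ → ℕ
choose2 zero    = 0
choose2 (suc a) = choose2 a + a

-- The ways to place the remaining 2 ∸ s copies of the new element into a partition with
-- a simple and b double blocks, as monomials relative to the exponents (X , Y):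
-- two simple blocks, a simple block and one copy of a double block, both copies of a
-- double block, or one copy each of two double blocks (each split double block
-- becomes two simple ones).
placements : ℕ → ℕ → ℕ → ℕ → ℕ → Poly
placements 0 a b X Y = copies (choose2 a) X Y ++ copies (a * b) (X + 2) (Y ∸ 1) ++ copies b X Y
                         ++ copies (choose2 b) (X + 2 + 2) (Y ∸ 1 ∸ 1)
placements 1 a b X Y = copies a X Y ++ copies b (X + 2) (Y ∸ 1)
placements 2 a b X Y = monomial X Y
placements _ a b X Y = []

copies-+ : ∀ m n x y → copies (m + n) x y ≡ copies m x y ++ copies n x y
copies-+ zero    n x y = refl
copies-+ (suc m) n x y = cong (_ ∷_) (copies-+ m n x y)

module _ where
  open ↭-Solver {A = ℚ × ℕ × ℕ} renaming (_⊕_ to _⊞_)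

  -- The extra simple block receives no copy of the new element, or one.
  placements-suc-simple : ∀ s a b X Y →
    placements s a b X Y ++ placements (suc s) a b X Y ++ [] ↭ placements s (suc a) b X Y
  placements-suc-simple 0 a b X Y rewrite copies-+ (choose2 a) a X Y | copies-+ b (a * b) (X + 2) (Y ∸ 1) =
    solve 6 (λ x₀ x₁ x₂ x₃ x₄ x₅ → (x₀ ⊞ x₁ ⊞ x₂ ⊞ x₃) ⊞ (x₄ ⊞ x₅) ⊞ id ⊜ (x₀ ⊞ x₄) ⊞ (x₅ ⊞ x₁) ⊞ x₂ ⊞ x₃) ↭-refl
      (copies (choose2 a) X Y) (copies (a * b) (X + 2) (Y ∸ 1)) (copies b X Y)
      (copies (choose2 b) (X + 2 + 2) (Y ∸ 1 ∸ 1)) (copies a X Y) (copies b (X + 2) (Y ∸ 1))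
  placements-suc-simple 1 a b X Y =
    solve 3 (λ x₀ x₁ x₂ → (x₀ ⊞ x₁) ⊞ x₂ ⊞ id ⊜ (x₂ ⊞ x₀) ⊞ x₁) ↭-refl
      (copies a X Y) (copies b (X + 2) (Y ∸ 1)) (monomial X Y)
  placements-suc-simple 2                   a b X Y = ↭-refl
  placements-suc-simple (suc (suc (suc s))) a b X Y = ↭-refl

  -- The extra double block receives no copy, one copy (and splits into two simple blocks),
  -- or both copies.
  placements-suc-double : ∀ s a b X Y →
    placements s a b X Y ++ placements (suc s) a b (X + 2) (Y ∸ 1) ++ placements (suc (suc s)) a b X Y ++ []
      ↭ placements s a (suc b) X Y
  placements-suc-double 0 a b X Y
    rewrite ℕ.*-suc a b | copies-+ a (a * b) (X + 2) (Y ∸ 1) | copies-+ (choose2 b) b (X + 2 + 2) (Y ∸ 1 ∸ 1) =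
    solve 7 (λ x₀ x₁ x₂ x₃ x₄ x₅ x₆ → (x₀ ⊞ x₁ ⊞ x₂ ⊞ x₃) ⊞ (x₄ ⊞ x₅) ⊞ x₆ ⊞ id
                                      ⊜ x₀ ⊞ (x₄ ⊞ x₁) ⊞ (x₆ ⊞ x₂) ⊞ (x₃ ⊞ x₅)) ↭-refl
      (copies (choose2 a) X Y) (copies (a * b) (X + 2) (Y ∸ 1)) (copies b X Y)
      (copies (choose2 b) (X + 2 + 2) (Y ∸ 1 ∸ 1)) (copies a (X + 2) (Y ∸ 1))
      (copies b (X + 2 + 2) (Y ∸ 1 ∸ 1)) (monomial X Y)
  placements-suc-double 1 a b X Y =
    solve 3 (λ x₀ x₁ x₂ → (x₀ ⊞ x₁) ⊞ x₂ ⊞ id ⊞ id ⊜ x₀ ⊞ (x₂ ⊞ x₁)) ↭-refl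
      (copies a X Y) (copies b (X + 2) (Y ∸ 1)) (monomial (X + 2) (Y ∸ 1))
  placements-suc-double 2                   a b X Y = ↭-refl
  placements-suc-double (suc (suc (suc s))) a b X Y = ↭-refl

splitWeights↭placements : ∀ {k} (p : Vec ℕ k) → All (_≤ 2) p → ∀ s e₁ e₂ X Y →
  X ≡ count 1 p + e₁ → Y ≡ count 2 p + e₂ → splitWeights s e₁ e₂ p ↭ placements s (count 1 p) (count 2 p) X Y
splitWeights↭placements [] [] 0                   e₁ e₂ X Y _    _    = ↭-refl
splitWeights↭placements [] [] 1                   e₁ e₂ X Y _    _    = ↭-refl
splitWeights↭placements [] [] 2                   e₁ e₂ X Y refl refl = ↭-refl
splitWeights↭placements [] [] (suc (suc (suc s))) e₁ e₂ X Y _    _    = ↭-refl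
splitWeights↭placements (0 ∷ v) (_ ∷ v≤2) s e₁ e₂ X Y X≡ Y≡ =
  ↭-trans (↭-reflexive (trans (sumOverSplits-∷ _ 0 v) (++-identityʳ _)))
          (splitWeights↭placements v v≤2 s e₁ e₂ X Y X≡ Y≡)
splitWeights↭placements (1 ∷ v) (_ ∷ v≤2) s e₁ e₂ X Y X≡ Y≡ =
  ↭-trans (↭-reflexive (sumOverSplits-∷ _ 1 v))
    (↭-trans (++⁺ (splitWeights↭placements v v≤2 s (suc e₁) e₂ X Y X≡′ Y≡)
             (++⁺ (splitWeights↭placements v v≤2 (suc s) (suc e₁) e₂ X Y X≡′ Y≡) ↭-refl))
             (placements-suc-simple s (count 1 v) (count 2 v) X Y))
  where
  X≡′ : X ≡ count 1 v + suc e₁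
  X≡′ = trans X≡ (sym (ℕ.+-suc _ e₁))
splitWeights↭placements (2 ∷ v) (_ ∷ v≤2) s e₁ e₂ X Y X≡ refl =
  ↭-trans (↭-reflexive (sumOverSplits-∷ _ 2 v))
    (↭-trans (++⁺ (splitWeights↭placements v v≤2 s e₁ (suc e₂) X _ X≡ Y≡′)
             (++⁺ (splitWeights↭placements v v≤2 (suc s) (suc (suc e₁)) e₂ (X + 2) _ X+2≡ refl)
             (++⁺ (splitWeights↭placements v v≤2 (suc (suc s)) e₁ (suc e₂) X _ X≡ Y≡′) ↭-refl)))
             (placements-suc-double s (count 1 v) (count 2 v) X (suc (count 2 v + e₂))))
  where
  Y≡′ : suc (count 2 v + e₂) ≡ count 2 v + suc e₂
  Y≡′ = sym (ℕ.+-suc _ e₂)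
  X+2≡ : X + 2 ≡ count 1 v + suc (suc e₁)
  X+2≡ = trans (cong (_+ 2) X≡) (trans (ℕ.+-assoc (count 1 v) e₁ 2) (cong (count 1 v +_) (ℕ.+-comm e₁ 2)))
splitWeights↭placements (suc (suc (suc c)) ∷ v) (s≤s (s≤s ()) ∷ _) s e₁ e₂ X Y X≡ Y≡

-- The new element ⋆ forms no singleton block {⋆}, or one, or two (leaving 2, 1 or 0 copies).
allPlacements : ℕ → ℕ → Poly
allPlacements a b = placements 0 a b a b ++ placements 1 a b (suc a) b ++ placements 2 a b a (suc b) ++ []

splitWeights↭allPlacements : ∀ {k} (p : Vec ℕ k) → All (_≤ 2) p →
  concatMap (λ m → splitWeights m (δ 1 m) (δ 2 m) p) 0‥2 ↭ allPlacements (count 1 p) (count 2 p)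
splitWeights↭allPlacements p p≤2 =
  ++⁺ (splitWeights↭placements p p≤2 0 0 0 _ _ (sym (ℕ.+-identityʳ _)) (sym (ℕ.+-identityʳ _)))
  (++⁺ (splitWeights↭placements p p≤2 1 1 0 _ _ (sym (ℕ.+-comm (count 1 p) 1)) (sym (ℕ.+-identityʳ _)))
  (++⁺ (splitWeights↭placements p p≤2 2 0 1 _ _ (sym (ℕ.+-identityʳ _)) (sym (ℕ.+-comm (count 2 p) 1))) ↭-refl))

-- Polynomials up to equality of coefficients

ℕtoℚ≡mkℚ : ∀ k → ℕtoℚ k ≡ mkℚ (ℤ.+ k) 0 (Coprime.sym (Coprime.1-coprimeTo k))
ℕtoℚ≡mkℚ k = ℚ.normalize-coprime {k} {0} (Coprime.sym (Coprime.1-coprimeTo k))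

ℕtoℚ-+ : ∀ m n → ℕtoℚ (m + n) ≡ ℕtoℚ m ℚ.+ ℕtoℚ n
ℕtoℚ-+ m n =
  trans (ℚ./-cong {ℤ.+ (m + n)} {1} {(ℤ.+ m) ℤ.* (ℤ.+ 1) ℤ.+ (ℤ.+ n) ℤ.* (ℤ.+ 1)} {1}
                  (cong₂ ℤ._+_ (sym (ℤ.*-identityʳ (ℤ.+ m))) (sym (ℤ.*-identityʳ (ℤ.+ n)))) refl)
        (sym (cong₂ ℚ._+_ (ℕtoℚ≡mkℚ m) (ℕtoℚ≡mkℚ n)))

ℕtoℚ-* : ∀ m n → ℕtoℚ (m * n) ≡ ℕtoℚ m ℚ.* ℕtoℚ n
ℕtoℚ-* m n =
  trans (ℚ./-cong {ℤ.+ (m * n)} {1} {(ℤ.+ m) ℤ.* (ℤ.+ n)} {1} (ℤ.pos-* m n) refl)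
        (sym (cong₂ ℚ._*_ (ℕtoℚ≡mkℚ m) (ℕtoℚ≡mkℚ n)))

ℕtoℚ-suc : ∀ k → ℕtoℚ (suc k) ≡ 1ℚ ℚ.+ ℕtoℚ k
ℕtoℚ-suc = ℕtoℚ-+ 1

n*[n∸1]≡2*choose2 : ∀ n → n * (n ∸ 1) ≡ 2 * choose2 n
n*[n∸1]≡2*choose2 zero          = refl
n*[n∸1]≡2*choose2 (suc zero)    = refl
n*[n∸1]≡2*choose2 (suc (suc n)) = begin
  suc (suc n) * suc n           ≡⟨ expand n ⟩
  suc n * n + 2 * suc n         ≡⟨ cong (_+ 2 * suc n) (n*[n∸1]≡2*choose2 (suc n)) ⟩
  2 * choose2 (suc n) + 2 * suc n ≡⟨ ℕ.*-distribˡ-+ 2 (choose2 (suc n)) (suc n) ⟨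
  2 * choose2 (suc (suc n))     ∎
  where
  open ≡-Reasoning
  expand : ∀ n → suc (suc n) * suc n ≡ suc n * n + 2 * suc n
  expand = solve-∀

½*n*[n∸1]≡choose2 : ∀ n → ½ ℚ.* (ℕtoℚ n ℚ.* ℕtoℚ (n ∸ 1)) ≡ ℕtoℚ (choose2 n)
½*n*[n∸1]≡choose2 n = begin
  ½ ℚ.* (ℕtoℚ n ℚ.* ℕtoℚ (n ∸ 1))   ≡⟨ cong (½ ℚ.*_) (ℕtoℚ-* n (n ∸ 1)) ⟨
  ½ ℚ.* ℕtoℚ (n * (n ∸ 1))          ≡⟨ cong (λ m → ½ ℚ.* ℕtoℚ m) (n*[n∸1]≡2*choose2 n) ⟩
  ½ ℚ.* ℕtoℚ (2 * choose2 n)        ≡⟨ cong (½ ℚ.*_) (ℕtoℚ-* 2 (choose2 n)) ⟩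
  ½ ℚ.* (ℕtoℚ 2 ℚ.* ℕtoℚ (choose2 n)) ≡⟨ ℚ.*-assoc ½ (ℕtoℚ 2) (ℕtoℚ (choose2 n)) ⟨
  1ℚ ℚ.* ℕtoℚ (choose2 n)           ≡⟨ ℚ.*-identityˡ (ℕtoℚ (choose2 n)) ⟩
  ℕtoℚ (choose2 n)                  ∎
  where open ≡-Reasoning

-- A record, so that both polynomials can be inferred from a proof of p ≃ q.
record _≃_ (p q : Poly) : Set where
  constructor mk≃
  field coeff-≡ : p ≈P q
open _≃_

infix 4 _≃_

≃-refl : ∀ {p} → p ≃ p
≃-refl = mk≃ (λ i j → refl)

≃-sym : ∀ {p q} → p ≃ q → q ≃ p
≃-sym (mk≃ e) = mk≃ (λ i j → sym (e i j))

≃-trans : ∀ {p q r} → p ≃ q → q ≃ r → p ≃ r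
≃-trans (mk≃ e) (mk≃ f) = mk≃ (λ i j → trans (e i j) (f i j))

≃-setoid : Setoid _ _
≃-setoid = record { Carrier = Poly ; _≈_ = _≃_
                  ; isEquivalence = record { refl = ≃-refl ; sym = ≃-sym ; trans = ≃-trans } }

termCoeff : ℚ × ℕ × ℕ → ℕ → ℕ → ℚ
termCoeff (c , a , b) i j = if (a ≡ᵇ i) ∧ (b ≡ᵇ j) then c else 0ℚ

coeff-++ : ∀ p q i j → coeff (p ++ q) i j ≡ coeff p i j ℚ.+ coeff q i j
coeff-++ []      q i j = sym (ℚ.+-identityˡ (coeff q i j))
coeff-++ (t ∷ p) q i j =
  trans (cong (termCoeff t i j ℚ.+_) (coeff-++ p q i j))
        (sym (ℚ.+-assoc (termCoeff t i j) (coeff p i j) (coeff q i j)))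

≃-++ : ∀ {p p′ q q′} → p ≃ p′ → q ≃ q′ → p ++ q ≃ p′ ++ q′
≃-++ {p} {p′} {q} {q′} (mk≃ e) (mk≃ f) = mk≃ λ i j →
  trans (coeff-++ p q i j) (trans (cong₂ ℚ._+_ (e i j) (f i j)) (sym (coeff-++ p′ q′ i j)))

≃-concatMap : {f g : A → Poly} → (∀ x → f x ≃ g x) → (xs : List A) → concatMap f xs ≃ concatMap g xs
≃-concatMap f≃g []       = ≃-refl
≃-concatMap f≃g (x ∷ xs) = ≃-++ (f≃g x) (≃-concatMap f≃g xs)

≃-when : ∀ c {p q} → p ≃ q → when c p ≃ when c q
≃-when true  p≃q = p≃q
≃-when false p≃q = ≃-refl

↭⇒≃ : ∀ {p q} → p ↭ q → p ≃ q
↭⇒≃ ↭.refl           = ≃-refl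
↭⇒≃ (↭.prep t p↭q)   = mk≃ λ i j → cong (termCoeff t i j ℚ.+_) (coeff-≡ (↭⇒≃ p↭q) i j)
↭⇒≃ (↭.swap {xs} {ys} s t p↭q) = mk≃ λ i j →
  trans (sym (ℚ.+-assoc (termCoeff s i j) (termCoeff t i j) (coeff xs i j)))
  (trans (cong₂ ℚ._+_ (ℚ.+-comm (termCoeff s i j) (termCoeff t i j)) (coeff-≡ (↭⇒≃ p↭q) i j))
         (ℚ.+-assoc (termCoeff t i j) (termCoeff s i j) (coeff ys i j)))
↭⇒≃ (↭.trans p↭q q↭r) = ≃-trans (↭⇒≃ p↭q) (↭⇒≃ q↭r)

copies≃term : ∀ k x y → copies k x y ≃ (ℕtoℚ k , x , y) ∷ []
copies≃term k x y = mk≃ (coefficients k)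
  where
  coefficients : ∀ k i j → coeff (copies k x y) i j ≡ coeff ((ℕtoℚ k , x , y) ∷ []) i j
  coefficients zero i j with (x ≡ᵇ i) ∧ (y ≡ᵇ j)
  ... | true  = refl
  ... | false = refl
  coefficients (suc k) i j with (x ≡ᵇ i) ∧ (y ≡ᵇ j) | coefficients k i j
  ... | true  | ih = trans (cong (1ℚ ℚ.+_) ih)
                     (trans (sym (ℚ.+-assoc 1ℚ (ℕtoℚ k) 0ℚ)) (cong (ℚ._+ 0ℚ) (sym (ℕtoℚ-suc k))))
  ... | false | ih = trans (cong (0ℚ ℚ.+_) ih) (ℚ.+-identityˡ _)

zero-term≃[] : ∀ x y → (0ℚ , x , y) ∷ [] ≃ []
zero-term≃[] x y = mk≃ λ i j → lemma ((x ≡ᵇ i) ∧ (y ≡ᵇ j))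
  where
  lemma : ∀ b → (if b then 0ℚ else 0ℚ) ℚ.+ 0ℚ ≡ 0ℚ
  lemma true  = refl
  lemma false = refl

-- Exponents only need to agree when the coefficient is nonzero: the derivatives in 𝒟₂
-- produce truncated exponents like a ∸ 1 exactly in the terms whose coefficient vanishes.
term≃copies : ∀ c x y k x′ y′ → c ≡ ℕtoℚ k → k ≡ 0 ⊎ (x ≡ x′ × y ≡ y′) → (c , x , y) ∷ [] ≃ copies k x′ y′
term≃copies c x y k x′ y′ refl (inj₁ refl)         = zero-term≃[] x y
term≃copies c x y k x′ y′ refl (inj₂ (refl , refl)) = ≃-sym (copies≃term k x y)

1*[1*x]≡x : ∀ x → 1ℚ ℚ.* (1ℚ ℚ.* x) ≡ x
1*[1*x]≡x x = trans (ℚ.*-identityˡ _) (ℚ.*-identityˡ x)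

½*[1*n]*[n∸1]≡choose2 : ∀ n → ½ ℚ.* (1ℚ ℚ.* ℕtoℚ n ℚ.* ℕtoℚ (n ∸ 1)) ≡ ℕtoℚ (choose2 n)
½*[1*n]*[n∸1]≡choose2 n =
  trans (cong (λ x → ½ ℚ.* (x ℚ.* ℕtoℚ (n ∸ 1))) (ℚ.*-identityˡ (ℕtoℚ n))) (½*n*[n∸1]≡choose2 n)

z₂D₂-monomial : ∀ a b → mulMon 1ℚ 0 1 (D₂ (monomial a b)) ≃ copies b a b
z₂D₂-monomial a b = term≃copies _ _ _ b a b (1*[1*x]≡x (ℕtoℚ b)) (exponents b)
  where
  exponents : ∀ b → b ≡ 0 ⊎ (0 + a ≡ a × 1 + (b ∸ 1) ≡ b)
  exponents zero    = inj₁ refl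
  exponents (suc b) = inj₂ (refl , refl)

z₁⁴D₂²-monomial : ∀ a b → mulMon ½ 4 0 (D₂ (D₂ (monomial a b))) ≃ copies (choose2 b) (a + 2 + 2) (b ∸ 1 ∸ 1)
z₁⁴D₂²-monomial a b = term≃copies _ _ _ (choose2 b) _ _ (½*[1*n]*[n∸1]≡choose2 b) (exponents b)
  where
  exponents : ∀ b → choose2 b ≡ 0 ⊎ (4 + a ≡ a + 2 + 2 × 0 + (b ∸ 1 ∸ 1) ≡ b ∸ 1 ∸ 1)
  exponents zero          = inj₁ refl
  exponents (suc zero)    = inj₁ refl
  exponents (suc (suc b)) = inj₂ (trans (ℕ.+-comm 4 a) (sym (ℕ.+-assoc a 2 2)) , refl)

z₁³D₁D₂-monomial : ∀ a b → mulMon 1ℚ 3 0 (D₁ (D₂ (monomial a b))) ≃ copies (a * b) (a + 2) (b ∸ 1)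
z₁³D₁D₂-monomial a b = term≃copies _ _ _ (a * b) _ _ coefficient (exponents a b)
  where
  coefficient : 1ℚ ℚ.* (1ℚ ℚ.* ℕtoℚ b ℚ.* ℕtoℚ a) ≡ ℕtoℚ (a * b)
  coefficient = trans (ℚ.*-identityˡ _) (trans (cong (ℚ._* ℕtoℚ a) (ℚ.*-identityˡ (ℕtoℚ b)))
                  (trans (ℚ.*-comm (ℕtoℚ b) (ℕtoℚ a)) (sym (ℕtoℚ-* a b))))
  exponents : ∀ a b → a * b ≡ 0 ⊎ (3 + (a ∸ 1) ≡ a + 2 × 0 + (b ∸ 1) ≡ b ∸ 1)
  exponents zero    b       = inj₁ refl
  exponents (suc a) zero    = inj₁ (ℕ.*-zeroʳ a)
  exponents (suc a) (suc b) = inj₂ (cong suc (ℕ.+-comm 2 a) , refl)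

z₁²D₁²-monomial : ∀ a b → mulMon ½ 2 0 (D₁ (D₁ (monomial a b))) ≃ copies (choose2 a) a b
z₁²D₁²-monomial a b = term≃copies _ _ _ (choose2 a) _ _ (½*[1*n]*[n∸1]≡choose2 a) (exponents a)
  where
  exponents : ∀ a → choose2 a ≡ 0 ⊎ (2 + (a ∸ 1 ∸ 1) ≡ a × 0 + b ≡ b)
  exponents zero          = inj₁ refl
  exponents (suc zero)    = inj₁ refl
  exponents (suc (suc a)) = inj₂ (refl , refl)

z₁³D₂-monomial : ∀ a b → mulMon 1ℚ 3 0 (D₂ (monomial a b)) ≃ copies b (suc a + 2) (b ∸ 1)
z₁³D₂-monomial a b = term≃copies _ _ _ b _ _ (1*[1*x]≡x (ℕtoℚ b)) (exponents b)
  where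
  exponents : ∀ b → b ≡ 0 ⊎ (3 + a ≡ suc a + 2 × 0 + (b ∸ 1) ≡ b ∸ 1)
  exponents zero    = inj₁ refl
  exponents (suc b) = inj₂ (cong suc (ℕ.+-comm 2 a) , refl)

z₁²D₁-monomial : ∀ a b → mulMon 1ℚ 2 0 (D₁ (monomial a b)) ≃ copies a (suc a) b
z₁²D₁-monomial a b = term≃copies _ _ _ a _ _ (1*[1*x]≡x (ℕtoℚ a)) (exponents a)
  where
  exponents : ∀ a → a ≡ 0 ⊎ (2 + (a ∸ 1) ≡ suc a × 0 + b ≡ b)
  exponents zero    = inj₁ refl
  exponents (suc a) = inj₂ (refl , refl)

z₂-monomial : ∀ a b → mulMon 1ℚ 0 1 (monomial a b) ≃ monomial a (suc b)
z₂-monomial a b = term≃copies _ _ _ 1 _ _ refl (inj₂ (refl , refl))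

allPlacements≃𝒟₂-monomial : ∀ a b → allPlacements a b ≃ 𝒟₂ (monomial a b)
allPlacements≃𝒟₂-monomial a b =
  ≃-trans (↭⇒≃ reorder)
          (≃-sym (≃-++ (z₂D₂-monomial a b) (≃-++ (z₁⁴D₂²-monomial a b) (≃-++ (z₁³D₁D₂-monomial a b)
                 (≃-++ (z₁²D₁²-monomial a b) (≃-++ (z₁³D₂-monomial a b) (≃-++ (z₁²D₁-monomial a b)
                 (z₂-monomial a b))))))))
  where
  reorder : allPlacements a b ↭
    copies b a b ++ copies (choose2 b) (a + 2 + 2) (b ∸ 1 ∸ 1) ++ copies (a * b) (a + 2) (b ∸ 1)
      ++ copies (choose2 a) a b ++ copies b (suc a + 2) (b ∸ 1) ++ copies a (suc a) b ++ monomial a (suc b)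
  reorder = solve 7 (λ r₁ r₂ r₃ r₄ r₅ r₆ r₇ → (r₄ ⊞ r₃ ⊞ r₁ ⊞ r₂) ⊞ (r₆ ⊞ r₅) ⊞ r₇ ⊞ id
                                            ⊜ r₁ ⊞ r₂ ⊞ r₃ ⊞ r₄ ⊞ r₅ ⊞ r₆ ⊞ r₇)
    ↭-refl (copies b a b) (copies (choose2 b) (a + 2 + 2) (b ∸ 1 ∸ 1)) (copies (a * b) (a + 2) (b ∸ 1))
           (copies (choose2 a) a b) (copies b (suc a + 2) (b ∸ 1)) (copies a (suc a) b) (monomial a (suc b))
    where open ↭-Solver {A = ℚ × ℕ × ℕ} renaming (_⊕_ to _⊞_)

Additive : (Poly → Poly) → Set
Additive F = ∀ p q → F (p ++ q) ≡ F p ++ F q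

∘-additive : ∀ F G → Additive F → Additive G → Additive (F ∘ G)
∘-additive F G F-add G-add p q = trans (cong F (G-add p q)) (F-add (G p) (G q))

D₁-additive : Additive D₁
D₁-additive = map-++ _

D₂-additive : Additive D₂
D₂-additive = map-++ _

mulMon-additive : ∀ c a b → Additive (mulMon c a b)
mulMon-additive c a b = map-++ _

𝒟₂-++ : ∀ p q → 𝒟₂ (p ++ q) ↭ 𝒟₂ p ++ 𝒟₂ q
𝒟₂-++ p q = ↭-trans (↭-reflexive componentwise) interleave
  where
  A₁ A₂ A₃ A₄ A₅ A₆ A₇ : Poly → Poly
  A₁ = mulMon 1ℚ 0 1 ∘ D₂
  A₂ = mulMon ½ 4 0 ∘ D₂ ∘ D₂
  A₃ = mulMon 1ℚ 3 0 ∘ D₁ ∘ D₂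
  A₄ = mulMon ½ 2 0 ∘ D₁ ∘ D₁
  A₅ = mulMon 1ℚ 3 0 ∘ D₂
  A₆ = mulMon 1ℚ 2 0 ∘ D₁
  A₇ = mulMon 1ℚ 0 1
  componentwise : 𝒟₂ (p ++ q) ≡ (A₁ p ++ A₁ q) ++ (A₂ p ++ A₂ q) ++ (A₃ p ++ A₃ q) ++ (A₄ p ++ A₄ q)
                                 ++ (A₅ p ++ A₅ q) ++ (A₆ p ++ A₆ q) ++ (A₇ p ++ A₇ q)
  componentwise =
    cong₂ _++_ (∘-additive (mulMon 1ℚ 0 1) D₂ (mulMon-additive 1ℚ 0 1) D₂-additive p q)
    (cong₂ _++_ (∘-additive (mulMon ½ 4 0) (D₂ ∘ D₂) (mulMon-additive ½ 4 0) D₂D₂-additive p q)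
    (cong₂ _++_ (∘-additive (mulMon 1ℚ 3 0) (D₁ ∘ D₂) (mulMon-additive 1ℚ 3 0) D₁D₂-additive p q)
    (cong₂ _++_ (∘-additive (mulMon ½ 2 0) (D₁ ∘ D₁) (mulMon-additive ½ 2 0) D₁D₁-additive p q)
    (cong₂ _++_ (∘-additive (mulMon 1ℚ 3 0) D₂ (mulMon-additive 1ℚ 3 0) D₂-additive p q)
    (cong₂ _++_ (∘-additive (mulMon 1ℚ 2 0) D₁ (mulMon-additive 1ℚ 2 0) D₁-additive p q)
                (mulMon-additive 1ℚ 0 1 p q))))))
    where
    D₂D₂-additive : Additive (D₂ ∘ D₂)
    D₂D₂-additive = ∘-additive D₂ D₂ D₂-additive D₂-additive
    D₁D₂-additive : Additive (D₁ ∘ D₂)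
    D₁D₂-additive = ∘-additive D₁ D₂ D₁-additive D₂-additive
    D₁D₁-additive : Additive (D₁ ∘ D₁)
    D₁D₁-additive = ∘-additive D₁ D₁ D₁-additive D₁-additive
  interleave : (A₁ p ++ A₁ q) ++ (A₂ p ++ A₂ q) ++ (A₃ p ++ A₃ q) ++ (A₄ p ++ A₄ q)
                 ++ (A₅ p ++ A₅ q) ++ (A₆ p ++ A₆ q) ++ (A₇ p ++ A₇ q) ↭ 𝒟₂ p ++ 𝒟₂ q
  interleave =
    solve 14 (λ a₁ a₂ a₃ a₄ a₅ a₆ a₇ b₁ b₂ b₃ b₄ b₅ b₆ b₇ →
                 (a₁ ⊞ b₁) ⊞ (a₂ ⊞ b₂) ⊞ (a₃ ⊞ b₃) ⊞ (a₄ ⊞ b₄) ⊞ (a₅ ⊞ b₅) ⊞ (a₆ ⊞ b₆) ⊞ (a₇ ⊞ b₇)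
               ⊜ (a₁ ⊞ a₂ ⊞ a₃ ⊞ a₄ ⊞ a₅ ⊞ a₆ ⊞ a₇) ⊞ (b₁ ⊞ b₂ ⊞ b₃ ⊞ b₄ ⊞ b₅ ⊞ b₆ ⊞ b₇))
          ↭-refl (A₁ p) (A₂ p) (A₃ p) (A₄ p) (A₅ p) (A₆ p) (A₇ p) (A₁ q) (A₂ q) (A₃ q) (A₄ q) (A₅ q) (A₆ q) (A₇ q)
    where open ↭-Solver {A = ℚ × ℕ × ℕ} renaming (_⊕_ to _⊞_)

𝒟₂-concatMap : (f : A → Poly) (xs : List A) → 𝒟₂ (concatMap f xs) ≃ concatMap (𝒟₂ ∘ f) xs
𝒟₂-concatMap f []       = ≃-refl
𝒟₂-concatMap f (x ∷ xs) = ≃-trans (↭⇒≃ (𝒟₂-++ (f x) (concatMap f xs))) (≃-++ ≃-refl (𝒟₂-concatMap f xs))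

𝒟₂-when : ∀ c p → 𝒟₂ (when c p) ≡ when c (𝒟₂ p)
𝒟₂-when true  p = refl
𝒟₂-when false p = refl

-- Subsets and multisets

emptySubset : ∀ n → Subset n
emptySubset zero    = []
emptySubset (suc n) = false ∷ emptySubset n

lookup-emptySubset : ∀ {n} (i : Fin n) → lookup (emptySubset n) i ≡ false
lookup-emptySubset zero    = refl
lookup-emptySubset (suc i) = lookup-emptySubset i

filterᵇ-nonempty-true∷ : ∀ {n} (Ss : List (Subset n)) → filterᵇ nonempty (map (true ∷_) Ss) ≡ map (true ∷_) Ss
filterᵇ-nonempty-true∷ []       = refl
filterᵇ-nonempty-true∷ (S ∷ Ss) = cong (_ ∷_) (filterᵇ-nonempty-true∷ Ss)

filterᵇ-nonempty-false∷ : ∀ {n} (Ss : List (Subset n)) →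
  filterᵇ nonempty (map (false ∷_) Ss) ≡ map (false ∷_) (filterᵇ nonempty Ss)
filterᵇ-nonempty-false∷ []       = refl
filterᵇ-nonempty-false∷ (S ∷ Ss) with nonempty S
... | true  = cong (_ ∷_) (filterᵇ-nonempty-false∷ Ss)
... | false = filterᵇ-nonempty-false∷ Ss

nonemptySubsets-suc-allSubsets : ∀ n →
  nonemptySubsets (suc n) ≡ map (true ∷_) (allSubsets n) ++ map (false ∷_) (nonemptySubsets n)
nonemptySubsets-suc-allSubsets n =
  trans (filter-++ (T? ∘ nonempty) (map (true ∷_) (allSubsets n)) (map (false ∷_) (allSubsets n)))
        (cong₂ _++_ (filterᵇ-nonempty-true∷ (allSubsets n)) (filterᵇ-nonempty-false∷ (allSubsets n)))

allSubsets≡nonemptySubsets∷ʳ∅ : ∀ n → allSubsets n ≡ nonemptySubsets n ++ [ emptySubset n ]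
allSubsets≡nonemptySubsets∷ʳ∅ zero    = refl
allSubsets≡nonemptySubsets∷ʳ∅ (suc n) = begin
  map (true ∷_) (allSubsets n) ++ map (false ∷_) (allSubsets n)
    ≡⟨ cong (λ Ss → map (true ∷_) (allSubsets n) ++ map (false ∷_) Ss) (allSubsets≡nonemptySubsets∷ʳ∅ n) ⟩
  map (true ∷_) (allSubsets n) ++ map (false ∷_) (nonemptySubsets n ++ [ emptySubset n ])
    ≡⟨ cong (map (true ∷_) (allSubsets n) ++_) (map-++ (false ∷_) (nonemptySubsets n) _) ⟩
  map (true ∷_) (allSubsets n) ++ map (false ∷_) (nonemptySubsets n) ++ [ emptySubset (suc n) ]
    ≡⟨ ++-assoc (map (true ∷_) (allSubsets n)) _ _ ⟨
  (map (true ∷_) (allSubsets n) ++ map (false ∷_) (nonemptySubsets n)) ++ [ emptySubset (suc n) ]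
    ≡⟨ cong (_++ [ emptySubset (suc n) ]) (nonemptySubsets-suc-allSubsets n) ⟨
  nonemptySubsets (suc n) ++ [ emptySubset (suc n) ] ∎
  where open ≡-Reasoning

nonemptySubsets-suc : ∀ n → nonemptySubsets (suc n) ≡
  map (true ∷_) (nonemptySubsets n ++ [ emptySubset n ]) ++ map (false ∷_) (nonemptySubsets n)
nonemptySubsets-suc n =
  trans (nonemptySubsets-suc-allSubsets n)
        (cong (λ Ss → map (true ∷_) Ss ++ map (false ∷_) (nonemptySubsets n)) (allSubsets≡nonemptySubsets∷ʳ∅ n))

nonempty⇒∃∈ : ∀ {n} (S : Subset n) → T (nonempty S) → Σ (Fin n) (λ i → lookup S i ≡ true)
nonempty⇒∃∈ (true  ∷ S) _ = zero , refl
nonempty⇒∃∈ (false ∷ S) t with nonempty⇒∃∈ S t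
... | i , S∋i = suc i , S∋i

toMultiset : ∀ {n} (Ss : List (Subset n)) → Vec ℕ (length Ss) → Multiset n
toMultiset []       []      = []
toMultiset (S ∷ Ss) (m ∷ v) = (S , m) ∷ toMultiset Ss v

assignments≡map-toMultiset : ∀ {n} (Ss : List (Subset n)) →
  assignments Ss ≡ map (toMultiset Ss) (multiplicities (length Ss))
assignments≡map-toMultiset []       = refl
assignments≡map-toMultiset (S ∷ Ss) = begin
  concatMap (λ m → map ((S , m) ∷_) (assignments Ss)) 0‥2
    ≡⟨ concatMap-cong (λ m → cong (map ((S , m) ∷_)) (assignments≡map-toMultiset Ss)) 0‥2 ⟩
  concatMap (λ m → map ((S , m) ∷_) (map (toMultiset Ss) ms)) 0‥2
    ≡⟨ concatMap-cong (λ m → sym (map-∘ {g = (S , m) ∷_} {f = toMultiset Ss} ms)) 0‥2 ⟩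
  concatMap (λ m → map (toMultiset (S ∷ Ss) ∘ (m ∷_)) ms) 0‥2
    ≡⟨ concatMap-cong (λ m → map-∘ {g = toMultiset (S ∷ Ss)} {f = m ∷_} ms) 0‥2 ⟩
  concatMap (λ m → map (toMultiset (S ∷ Ss)) (map (m ∷_) ms)) 0‥2
    ≡⟨ map-concatMap (toMultiset (S ∷ Ss)) (λ m → map (m ∷_) ms) 0‥2 ⟨
  map (toMultiset (S ∷ Ss)) (multiplicities (length (S ∷ Ss))) ∎
  where
  open ≡-Reasoning
  ms : List (Vec ℕ (length Ss))
  ms = multiplicities (length Ss)

mapSets : ∀ {n} → (Subset n → Subset (suc n)) → Multiset n → Multiset (suc n)
mapSets h = map (λ (S , m) → (h S , m))

concatMap-assignments-∷ : ∀ {n} (F : Multiset n → List B) (S : Subset n) (Ss : List (Subset n)) →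
  concatMap F (assignments (S ∷ Ss)) ≡ concatMap (λ m → concatMap (λ π → F ((S , m) ∷ π)) (assignments Ss)) 0‥2
concatMap-assignments-∷ F S Ss =
  trans (concatMap-concatMap F (λ m → map ((S , m) ∷_) (assignments Ss)) 0‥2)
        (concatMap-cong (λ m → concatMap-map F ((S , m) ∷_) (assignments Ss)) 0‥2)

concatMap-assignments-++ : ∀ {n} (F : Multiset n → List B) (Ss Tt : List (Subset n)) →
  concatMap F (assignments (Ss ++ Tt)) ≡
    concatMap (λ α → concatMap (λ β → F (α ++ β)) (assignments Tt)) (assignments Ss)
concatMap-assignments-++ F []       Tt = sym (++-identityʳ _)
concatMap-assignments-++ F (S ∷ Ss) Tt =
  trans (concatMap-assignments-∷ F S (Ss ++ Tt))
  (trans (concatMap-cong (λ m → concatMap-assignments-++ (λ π → F ((S , m) ∷ π)) Ss Tt) 0‥2)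
         (sym (concatMap-assignments-∷ (λ α → concatMap (λ β → F (α ++ β)) (assignments Tt)) S Ss)))

concatMap-assignments-map : ∀ {n} (F : Multiset (suc n) → List B) (h : Subset n → Subset (suc n))
  (Ss : List (Subset n)) → concatMap F (assignments (map h Ss)) ≡ concatMap (F ∘ mapSets h) (assignments Ss)
concatMap-assignments-map F h []       = refl
concatMap-assignments-map F h (S ∷ Ss) =
  trans (concatMap-assignments-∷ F (h S) (map h Ss))
  (trans (concatMap-cong (λ m → concatMap-assignments-map (λ π → F ((h S , m) ∷ π)) h Ss) 0‥2)
         (sym (concatMap-assignments-∷ (F ∘ mapSets h) S Ss)))

concatMap-assignments : ∀ {n} (F : Multiset n → List B) (Ss : List (Subset n)) →
  concatMap F (assignments Ss) ≡ concatMap (F ∘ toMultiset Ss) (multiplicities (length Ss))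
concatMap-assignments F Ss =
  trans (cong (concatMap F) (assignments≡map-toMultiset Ss))
        (concatMap-map F (toMultiset Ss) (multiplicities (length Ss)))

onlyIf : Bool → ℕ → ℕ
onlyIf b k = if b then k else 0

onlyIf-+ : ∀ b x y → onlyIf b (x + y) ≡ onlyIf b x + onlyIf b y
onlyIf-+ true  x y = refl
onlyIf-+ false x y = refl

totalMultiplicity : ∀ {n} → Multiset n → ℕ
totalMultiplicity []            = 0
totalMultiplicity ((S , k) ∷ π) = k + totalMultiplicity π

totalMultiplicity-++ : ∀ {n} (π ρ : Multiset n) →
  totalMultiplicity (π ++ ρ) ≡ totalMultiplicity π + totalMultiplicity ρ
totalMultiplicity-++ []            ρ = refl
totalMultiplicity-++ ((S , k) ∷ π) ρ =
  trans (cong (k +_) (totalMultiplicity-++ π ρ)) (sym (ℕ.+-assoc k (totalMultiplicity π) (totalMultiplicity ρ)))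

totalMultiplicity-toMultiset : ∀ {n} (Ss : List (Subset n)) v → totalMultiplicity (toMultiset Ss v) ≡ sum v
totalMultiplicity-toMultiset []       []      = refl
totalMultiplicity-toMultiset (S ∷ Ss) (m ∷ v) = cong (m +_) (totalMultiplicity-toMultiset Ss v)

cover-++ : ∀ {n} (i : Fin n) π ρ → cover i (π ++ ρ) ≡ cover i π + cover i ρ
cover-++ i []            ρ = refl
cover-++ i ((S , k) ∷ π) ρ =
  trans (cong (onlyIf (lookup S i) k +_) (cover-++ i π ρ))
        (sym (ℕ.+-assoc (onlyIf (lookup S i) k) (cover i π) (cover i ρ)))

cover-zero-true∷ : ∀ {n} (π : Multiset n) → cover zero (mapSets (true ∷_) π) ≡ totalMultiplicity π
cover-zero-true∷ []            = refl
cover-zero-true∷ ((S , k) ∷ π) = cong (k +_) (cover-zero-true∷ π)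

cover-zero-false∷ : ∀ {n} (π : Multiset n) → cover zero (mapSets (false ∷_) π) ≡ 0
cover-zero-false∷ []            = refl
cover-zero-false∷ ((S , k) ∷ π) = cover-zero-false∷ π

cover-suc-∷ : ∀ {n} b (i : Fin n) (π : Multiset n) → cover (suc i) (mapSets (b ∷_) π) ≡ cover i π
cover-suc-∷ b i []            = refl
cover-suc-∷ b i ((S , k) ∷ π) = cong (onlyIf (lookup S i) k +_) (cover-suc-∷ b i π)

cover-emptySubset : ∀ {n} (i : Fin n) m → cover i [ (emptySubset n , m) ] ≡ 0
cover-emptySubset i m rewrite lookup-emptySubset i = refl

cover-toMultiset-⊕ : ∀ {n} (i : Fin n) (Ss : List (Subset n)) g b →
  cover i (toMultiset Ss (g ⊕ᵥ b)) ≡ cover i (toMultiset Ss g) + cover i (toMultiset Ss b)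
cover-toMultiset-⊕ i []       []      []      = refl
cover-toMultiset-⊕ i (S ∷ Ss) (x ∷ g) (y ∷ b)
  rewrite cover-toMultiset-⊕ i Ss g b | onlyIf-+ (lookup S i) x y =
    interchange (onlyIf (lookup S i) x) (onlyIf (lookup S i) y) (cover i (toMultiset Ss g)) (cover i (toMultiset Ss b))
  where
  interchange : ∀ a b c d → a + b + (c + d) ≡ a + c + (b + d)
  interchange = solve-∀

aCount-∷ : ∀ {n} k (S : Subset n) m π → aCount k ((S , m) ∷ π) ≡ δ k m + aCount k π
aCount-∷ k S m π with m ≡ᵇ k
... | true  = refl
... | false = refl

aCount-++ : ∀ {n} k (π ρ : Multiset n) → aCount k (π ++ ρ) ≡ aCount k π + aCount k ρ
aCount-++ k []            ρ = refl
aCount-++ k ((S , m) ∷ π) ρ = begin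
  aCount k ((S , m) ∷ π ++ ρ)        ≡⟨ aCount-∷ k S m (π ++ ρ) ⟩
  δ k m + aCount k (π ++ ρ)          ≡⟨ cong (δ k m +_) (aCount-++ k π ρ) ⟩
  δ k m + (aCount k π + aCount k ρ)  ≡⟨ ℕ.+-assoc (δ k m) _ _ ⟨
  δ k m + aCount k π + aCount k ρ    ≡⟨ cong (_+ aCount k ρ) (aCount-∷ k S m π) ⟨
  aCount k ((S , m) ∷ π) + aCount k ρ ∎
  where open ≡-Reasoning

aCount-mapSets : ∀ {n} k h (π : Multiset n) → aCount k (mapSets h π) ≡ aCount k π
aCount-mapSets k h []            = refl
aCount-mapSets k h ((S , m) ∷ π) =
  trans (aCount-∷ k (h S) m (mapSets h π)) (trans (cong (δ k m +_) (aCount-mapSets k h π)) (sym (aCount-∷ k S m π)))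

aCount-toMultiset : ∀ {n} k (Ss : List (Subset n)) v → aCount k (toMultiset Ss v) ≡ count k v
aCount-toMultiset k []       []      = refl
aCount-toMultiset k (S ∷ Ss) (m ∷ v) =
  trans (aCount-∷ k S m (toMultiset Ss v)) (cong (δ k m +_) (aCount-toMultiset k Ss v))

allFinᵇ : ∀ n → (Fin n → Bool) → Bool
allFinᵇ zero    h = true
allFinᵇ (suc n) h = h zero ∧ allFinᵇ n (h ∘ suc)

allᵇ-tabulate : ∀ n (f : A → Bool) (g : Fin n → A) → allᵇ f (tabulate g) ≡ allFinᵇ n (f ∘ g)
allᵇ-tabulate zero    f g = refl
allᵇ-tabulate (suc n) f g = cong (f (g zero) ∧_) (allᵇ-tabulate n f (g ∘ suc))

isPartition≡allFinᵇ : ∀ {n} (π : Multiset n) → isPartition π ≡ allFinᵇ n (λ i → cover i π ≡ᵇ 2)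
isPartition≡allFinᵇ {n} π = allᵇ-tabulate n (λ i → cover i π ≡ᵇ 2) (λ i → i)

allFinᵇ-cong : ∀ n {h h′ : Fin n → Bool} → (∀ i → h i ≡ h′ i) → allFinᵇ n h ≡ allFinᵇ n h′
allFinᵇ-cong zero    h≡h′ = refl
allFinᵇ-cong (suc n) h≡h′ = cong₂ _∧_ (h≡h′ zero) (allFinᵇ-cong n (h≡h′ ∘ suc))

allFinᵇ⇒ : ∀ n (h : Fin n → Bool) → allFinᵇ n h ≡ true → ∀ i → h i ≡ true
allFinᵇ⇒ (suc n) h all i with h zero in h₀
allFinᵇ⇒ (suc n) h all  zero    | true = h₀
allFinᵇ⇒ (suc n) h all  (suc i) | true = allFinᵇ⇒ n (h ∘ suc) all i
allFinᵇ⇒ (suc n) h ()   i       | false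

-- The recurrence

weightAcc-closed : ∀ {k} (g b : Vec ℕ k) s e₁ e₂ → weightAcc g b s e₁ e₂ ≡
  when (sum g + s ≡ᵇ 2) (monomial (count 1 g + count 1 b + e₁) (count 2 g + count 2 b + e₂))
weightAcc-closed []      []      s e₁ e₂ = refl
weightAcc-closed (c ∷ γ) (d ∷ β) s e₁ e₂ =
  trans (weightAcc-closed γ β (c + s) (δ 1 c + (δ 1 d + e₁)) (δ 2 c + (δ 2 d + e₂)))
        (cong₂ (λ t (x , y) → when (t ≡ᵇ 2) (monomial x y))
               (shift (sum γ) c s)
               (cong₂ _,_ (interleave (count 1 γ) (count 1 β) (δ 1 c) (δ 1 d) e₁)
                          (interleave (count 2 γ) (count 2 β) (δ 2 c) (δ 2 d) e₂)))
  where
  shift : ∀ t c s → t + (c + s) ≡ c + t + s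
  shift = solve-∀
  interleave : ∀ x y p q e → x + y + (p + (q + e)) ≡ p + x + (q + y) + e
  interleave = solve-∀

weight : ∀ {n} → Multiset n → ℚ × ℕ × ℕ
weight π = (1ℚ , aCount 1 π , aCount 2 π)

partitionTerm : ∀ {n} → Multiset n → Poly
partitionTerm π = when (isPartition π) [ weight π ]

P⁽²⁾≡concatMap-partitionTerm : ∀ n → P⁽²⁾ n ≡
  concatMap (partitionTerm ∘ toMultiset (nonemptySubsets n)) (multiplicities (length (nonemptySubsets n)))
P⁽²⁾≡concatMap-partitionTerm n =
  trans (map-filterᵇ weight isPartition (assignments (nonemptySubsets n)))
        (concatMap-assignments partitionTerm (nonemptySubsets n))

∃-overcovered : ∀ {n} (Ss : List (Subset n)) → ListAll.All (T ∘ nonempty) Ss → (v : Vec ℕ (length Ss)) →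
  Any (3 ≤_) v → Σ (Fin n) (λ i → 3 ≤ cover i (toMultiset Ss v))
∃-overcovered (S ∷ Ss) (S≢∅ ∷ _) (c ∷ v) (here 3≤c) with nonempty⇒∃∈ S S≢∅
... | i , S∋i = i , subst (λ t → 3 ≤ onlyIf t c + cover i (toMultiset Ss v)) (sym S∋i) (ℕ.≤-trans 3≤c (ℕ.m≤m+n c _))
∃-overcovered (S ∷ Ss) (_ ∷ Ss≢∅) (c ∷ v) (there big) with ∃-overcovered Ss Ss≢∅ v big
... | i , 3≤cover = i , ℕ.≤-trans 3≤cover (ℕ.m≤n+m _ _)

-- The new element ⋆ is the coordinate zero of Fin (suc n).  A multiset of nonempty subsets
-- of Fin (suc n) is given by the multiplicities g of the blocks T ∪ {⋆}, m of the block {⋆}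
-- and b of the blocks T, where T ranges over the nonempty subsets of Fin n.
module NewElement (n : ℕ) where

  Ts : List (Subset n)
  Ts = nonemptySubsets n

  K : ℕ
  K = length Ts

  isPartitionᵥ : Vec ℕ K → Bool
  isPartitionᵥ v = isPartition (toMultiset Ts v)

  ∅ : Subset n
  ∅ = emptySubset n

  ⋆-blocks : Vec ℕ K → ℕ → Multiset n
  ⋆-blocks g m = toMultiset Ts g ++ [ (∅ , m) ]

  extend : Vec ℕ K → ℕ → Vec ℕ K → Multiset (suc n)
  extend g m b = mapSets (true ∷_) (⋆-blocks g m) ++ mapSets (false ∷_) (toMultiset Ts b)

  P⁽²⁾-suc≡ : P⁽²⁾ (suc n) ≡
    concatMap (λ g → concatMap (λ m → concatMap (λ b → partitionTerm (extend g m b)) (multiplicities K)) 0‥2)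
              (multiplicities K)
  P⁽²⁾-suc≡ = begin
    P⁽²⁾ (suc n)
      ≡⟨ map-filterᵇ weight isPartition (assignments (nonemptySubsets (suc n))) ⟩
    concatMap partitionTerm (assignments (nonemptySubsets (suc n)))
      ≡⟨ cong (concatMap partitionTerm ∘ assignments) (nonemptySubsets-suc n) ⟩
    concatMap partitionTerm (assignments (map (true ∷_) (Ts ++ [ ∅ ]) ++ map (false ∷_) Ts))
      ≡⟨ concatMap-assignments-++ partitionTerm (map (true ∷_) (Ts ++ [ ∅ ])) (map (false ∷_) Ts) ⟩
    concatMap (λ α → concatMap (λ β → partitionTerm (α ++ β)) (assignments (map (false ∷_) Ts)))
              (assignments (map (true ∷_) (Ts ++ [ ∅ ])))
      ≡⟨ concatMap-assignments-map _ (true ∷_) (Ts ++ [ ∅ ]) ⟩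
    concatMap (λ α → concatMap (λ β → partitionTerm (mapSets (true ∷_) α ++ β)) (assignments (map (false ∷_) Ts)))
              (assignments (Ts ++ [ ∅ ]))
      ≡⟨ concatMap-cong (λ α → concatMap-assignments-map _ (false ∷_) Ts) (assignments (Ts ++ [ ∅ ])) ⟩
    concatMap (λ α → concatMap (λ β → partitionTerm (mapSets (true ∷_) α ++ mapSets (false ∷_) β)) (assignments Ts))
              (assignments (Ts ++ [ ∅ ]))
      ≡⟨ concatMap-assignments-++ _ Ts [ ∅ ] ⟩
    concatMap (λ α → concatMap (λ μ → concatMap (λ β → partitionTerm (mapSets (true ∷_) (α ++ μ) ++ mapSets (false ∷_) β))
                                                 (assignments Ts))
                               (assignments [ ∅ ]))
              (assignments Ts)
      ≡⟨ concatMap-assignments _ Ts ⟩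
    concatMap (λ g → concatMap (λ μ → concatMap (λ β → partitionTerm (mapSets (true ∷_) (toMultiset Ts g ++ μ)
                                                                       ++ mapSets (false ∷_) β))
                                                 (assignments Ts))
                               (assignments [ ∅ ]))
              (multiplicities K)
      ≡⟨ concatMap-cong (λ g → concatMap-cong (λ m → concatMap-assignments (λ β →
           partitionTerm (mapSets (true ∷_) (toMultiset Ts g ++ [ (∅ , m) ]) ++ mapSets (false ∷_) β)) Ts)
           0‥2) (multiplicities K) ⟩
    concatMap (λ g → concatMap (λ m → concatMap (λ b → partitionTerm (extend g m b)) (multiplicities K)) 0‥2)
              (multiplicities K) ∎
    where open ≡-Reasoning

  cover-zero-extend : ∀ g m b → cover zero (extend g m b) ≡ sum g + m
  cover-zero-extend g m b = begin
    cover zero (extend g m b)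
      ≡⟨ cover-++ zero (mapSets (true ∷_) (⋆-blocks g m)) _ ⟩
    cover zero (mapSets (true ∷_) (⋆-blocks g m)) + cover zero (mapSets (false ∷_) (toMultiset Ts b))
      ≡⟨ cong₂ _+_ (cover-zero-true∷ (⋆-blocks g m)) (cover-zero-false∷ (toMultiset Ts b)) ⟩
    totalMultiplicity (⋆-blocks g m) + 0
      ≡⟨ ℕ.+-identityʳ _ ⟩
    totalMultiplicity (⋆-blocks g m)
      ≡⟨ totalMultiplicity-++ (toMultiset Ts g) _ ⟩
    totalMultiplicity (toMultiset Ts g) + (m + 0)
      ≡⟨ cong₂ _+_ (totalMultiplicity-toMultiset Ts g) (ℕ.+-identityʳ m) ⟩
    sum g + m ∎
    where open ≡-Reasoning

  cover-suc-extend : ∀ g m b (i : Fin n) → cover (suc i) (extend g m b) ≡ cover i (toMultiset Ts (g ⊕ᵥ b))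
  cover-suc-extend g m b i = begin
    cover (suc i) (extend g m b)
      ≡⟨ cover-++ (suc i) (mapSets (true ∷_) (⋆-blocks g m)) _ ⟩
    cover (suc i) (mapSets (true ∷_) (⋆-blocks g m))
      + cover (suc i) (mapSets (false ∷_) (toMultiset Ts b))
      ≡⟨ cong₂ _+_ (cover-suc-∷ true i (⋆-blocks g m)) (cover-suc-∷ false i (toMultiset Ts b)) ⟩
    cover i (⋆-blocks g m) + cover i (toMultiset Ts b)
      ≡⟨ cong (_+ cover i (toMultiset Ts b)) (cover-++ i (toMultiset Ts g) _) ⟩
    cover i (toMultiset Ts g) + cover i [ (∅ , m) ] + cover i (toMultiset Ts b)
      ≡⟨ cong (λ c → cover i (toMultiset Ts g) + c + cover i (toMultiset Ts b)) (cover-emptySubset i m) ⟩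
    cover i (toMultiset Ts g) + 0 + cover i (toMultiset Ts b)
      ≡⟨ cong (_+ cover i (toMultiset Ts b)) (ℕ.+-identityʳ _) ⟩
    cover i (toMultiset Ts g) + cover i (toMultiset Ts b)
      ≡⟨ cover-toMultiset-⊕ i Ts g b ⟨
    cover i (toMultiset Ts (g ⊕ᵥ b)) ∎
    where open ≡-Reasoning

  isPartition-extend : ∀ g m b → isPartition (extend g m b) ≡ (sum g + m ≡ᵇ 2) ∧ isPartitionᵥ (g ⊕ᵥ b)
  isPartition-extend g m b =
    trans (isPartition≡allFinᵇ (extend g m b))
          (cong₂ _∧_ (cong (_≡ᵇ 2) (cover-zero-extend g m b))
                     (trans (allFinᵇ-cong n (λ i → cong (_≡ᵇ 2) (cover-suc-extend g m b i)))
                            (sym (isPartition≡allFinᵇ (toMultiset Ts (g ⊕ᵥ b))))))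

  aCount-extend : ∀ k g m b → aCount k (extend g m b) ≡ count k g + count k b + δ k m
  aCount-extend k g m b = begin
    aCount k (extend g m b)
      ≡⟨ aCount-++ k (mapSets (true ∷_) (⋆-blocks g m)) _ ⟩
    aCount k (mapSets (true ∷_) (⋆-blocks g m)) + aCount k (mapSets (false ∷_) (toMultiset Ts b))
      ≡⟨ cong₂ _+_ (aCount-mapSets k (true ∷_) (⋆-blocks g m))
                   (aCount-mapSets k (false ∷_) (toMultiset Ts b)) ⟩
    aCount k (⋆-blocks g m) + aCount k (toMultiset Ts b)
      ≡⟨ cong₂ _+_ (aCount-++ k (toMultiset Ts g) _) (aCount-toMultiset k Ts b) ⟩
    aCount k (toMultiset Ts g) + aCount k [ (∅ , m) ] + count k b
      ≡⟨ cong₂ (λ x y → x + y + count k b) (aCount-toMultiset k Ts g) (aCount-∷ k ∅ m []) ⟩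
    count k g + (δ k m + 0) + count k b
      ≡⟨ rearrange (count k g) (δ k m) (count k b) ⟩
    count k g + count k b + δ k m ∎
    where
    open ≡-Reasoning
    rearrange : ∀ x y z → x + (y + 0) + z ≡ x + z + y
    rearrange = solve-∀

  partitionTerm-extend : ∀ g m b →
    partitionTerm (extend g m b) ≡ when (isPartitionᵥ (g ⊕ᵥ b)) (weightAcc g b m (δ 1 m) (δ 2 m))
  partitionTerm-extend g m b = begin
    partitionTerm (extend g m b)
      ≡⟨ cong₂ (λ c t → when c [ t ]) (isPartition-extend g m b)
               (cong₂ (λ x y → (1ℚ , x , y)) (aCount-extend 1 g m b) (aCount-extend 2 g m b)) ⟩
    when ((sum g + m ≡ᵇ 2) ∧ isPartitionᵥ (g ⊕ᵥ b))
         (monomial (count 1 g + count 1 b + δ 1 m) (count 2 g + count 2 b + δ 2 m))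
      ≡⟨ when-∧ (sum g + m ≡ᵇ 2) (isPartitionᵥ (g ⊕ᵥ b)) _ ⟩
    when (isPartitionᵥ (g ⊕ᵥ b))
         (when (sum g + m ≡ᵇ 2) (monomial (count 1 g + count 1 b + δ 1 m) (count 2 g + count 2 b + δ 2 m)))
      ≡⟨ cong (when (isPartitionᵥ (g ⊕ᵥ b))) (weightAcc-closed g b m (δ 1 m) (δ 2 m)) ⟨
    when (isPartitionᵥ (g ⊕ᵥ b)) (weightAcc g b m (δ 1 m) (δ 2 m)) ∎
    where open ≡-Reasoning

  isPartitionᵥ-vanishesAbove2 : VanishesAbove2 isPartitionᵥ
  isPartitionᵥ-vanishesAbove2 v big with ∃-overcovered Ts (all-filter (T? ∘ nonempty) (allSubsets n)) v big
  ... | i , 3≤cover with isPartitionᵥ v in isP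
  ...   | false = refl
  ...   | true  = ⊥-elim (ℕ.<⇒≢ 3≤cover (sym cover≡2))
    where
    cover≡2 : cover i (toMultiset Ts v) ≡ 2
    cover≡2 = ℕ.≡ᵇ⇒≡ _ 2 (subst T (sym (allFinᵇ⇒ n _ (trans (sym (isPartition≡allFinᵇ (toMultiset Ts v))) isP) i)) tt)

  P⁽²⁾-suc↭ : P⁽²⁾ (suc n) ↭
    concatMap (λ p → when (isPartitionᵥ p) (allPlacements (count 1 p) (count 2 p))) (multiplicities K)
  P⁽²⁾-suc↭ = begin
    P⁽²⁾ (suc n)
      ≡⟨ trans P⁽²⁾-suc≡
               (concatMap-cong (λ g → concatMap-cong (λ m → concatMap-cong (partitionTerm-extend g m) ms) 0‥2) ms) ⟩
    concatMap (λ g → concatMap (λ m → concatMap (λ b → when (φ (g ⊕ᵥ b)) (w m g b)) ms) 0‥2) ms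
      ↭⟨ concatMap-comm (λ g m → concatMap (λ b → when (φ (g ⊕ᵥ b)) (w m g b)) ms) ms 0‥2 ⟩
    concatMap (λ m → pairSum K φ (w m)) 0‥2
      ↭⟨ concatMap⁺ (λ m → pairSum↭splitSum K φ (w m) isPartitionᵥ-vanishesAbove2) 0‥2 ⟩
    concatMap (λ m → splitSum K φ (w m)) 0‥2
      ↭⟨ concatMap-comm (λ m p → when (φ p) (splitWeights m (δ 1 m) (δ 2 m) p)) 0‥2 ms ⟩
    concatMap (λ p → concatMap (λ m → when (φ p) (splitWeights m (δ 1 m) (δ 2 m) p)) 0‥2) ms
      ≡⟨ concatMap-cong (λ p → when-concatMap (φ p) (λ m → splitWeights m (δ 1 m) (δ 2 m) p) 0‥2) ms ⟨
    concatMap (λ p → when (φ p) (concatMap (λ m → splitWeights m (δ 1 m) (δ 2 m) p) 0‥2)) ms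
      ↭⟨ concatMap-multiplicities-cong K (λ p p≤2 → when⁺ (φ p) (splitWeights↭allPlacements p p≤2)) ⟩
    concatMap (λ p → when (φ p) (allPlacements (count 1 p) (count 2 p))) ms ∎
    where
    open PermutationReasoning
    ms : List (Vec ℕ K)
    ms = multiplicities K
    φ : Vec ℕ K → Bool
    φ = isPartitionᵥ
    w : ℕ → Vec ℕ K → Vec ℕ K → Poly
    w m g b = weightAcc g b m (δ 1 m) (δ 2 m)

  recurrence : P⁽²⁾ (suc n) ≃ 𝒟₂ (P⁽²⁾ n)
  recurrence = begin
    P⁽²⁾ (suc n)
      ≈⟨ ↭⇒≃ P⁽²⁾-suc↭ ⟩
    concatMap (λ p → when (isPartitionᵥ p) (allPlacements (count 1 p) (count 2 p))) ms
      ≈⟨ ≃-concatMap (λ p → ≃-when (isPartitionᵥ p) (allPlacements≃𝒟₂-monomial (count 1 p) (count 2 p))) ms ⟩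
    concatMap (λ p → when (isPartitionᵥ p) (𝒟₂ (monomial (count 1 p) (count 2 p)))) ms
      ≡⟨ concatMap-cong (λ p → trans (sym (𝒟₂-when (isPartitionᵥ p) _))
                                     (cong 𝒟₂ (cong (when (isPartitionᵥ p)) (weight-toMultiset p)))) ms ⟩
    concatMap (𝒟₂ ∘ partitionTerm ∘ toMultiset Ts) ms
      ≈⟨ 𝒟₂-concatMap (partitionTerm ∘ toMultiset Ts) ms ⟨
    𝒟₂ (concatMap (partitionTerm ∘ toMultiset Ts) ms)
      ≡⟨ cong 𝒟₂ (P⁽²⁾≡concatMap-partitionTerm n) ⟨
    𝒟₂ (P⁽²⁾ n) ∎
    where
    open SetoidReasoning ≃-setoid
    ms : List (Vec ℕ K)
    ms = multiplicities K
    weight-toMultiset : ∀ p → monomial (count 1 p) (count 2 p) ≡ [ weight (toMultiset Ts p) ]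
    weight-toMultiset p = cong₂ monomial (sym (aCount-toMultiset 1 Ts p)) (sym (aCount-toMultiset 2 Ts p))

powQ-1ℚ : ∀ k → powQ 1ℚ k ≡ 1ℚ
powQ-1ℚ zero    = refl
powQ-1ℚ (suc k) = cong (1ℚ ℚ.*_) (powQ-1ℚ k)

length≡eval-1 : ∀ {n} (πs : List (Multiset n)) → ℕtoℚ (length πs) ≡ eval (map weight πs) 1ℚ 1ℚ
length≡eval-1 []       = refl
length≡eval-1 (π ∷ πs) =
  trans (ℕtoℚ-suc (length πs))
        (cong₂ ℚ._+_ (sym (cong₂ (λ x y → 1ℚ ℚ.* x ℚ.* y) (powQ-1ℚ (aCount 1 π)) (powQ-1ℚ (aCount 2 π))))
                     (length≡eval-1 πs))

mainTheorem1 : (∀ (n : ℕ) → P⁽²⁾ (suc n) ≈P 𝒟₂ (P⁽²⁾ n))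
               × (∀ (n : ℕ) → ℕtoℚ (length (partitions n)) ≡ eval (P⁽²⁾ n) 1ℚ 1ℚ)
mainTheorem1 = (λ n → coeff-≡ (NewElement.recurrence n)) , (λ n → length≡eval-1 (partitions n))
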